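{- Let $(\mathbb{C},P)$ be an elementary existential doctrine. If an object $A$ of $\mathbb{C}$ is complete, then $A$ is a $P$-sheaf.
   Context: A doctrine is a pair $(\mathbb{C},P)$ with $\mathbb{C}$ a category with finite products and $P:\mathbb{C}^{op}\to\mathbf{ISL}$ a functor into inf-semilattices and their homomorphisms; write $f^*=P(f)$, $\wedge$ for binary meets and $\top_A$ for the top of $P(A)$. It is elementary existential if every $f^*$ has a left adjoint $\exists_f\dashv f^*$ satisfying the Beck–Chevalley condition for pullbacks ($\exists_f\circ g^*=h^*\circ\exists_k$ whenever $k\circ g=h\circ f$ is a pullback with $f:X\to Y$, $g:X\to Z$, $h:Y\to W$, $k:Z\to W$) and Frobenius reciprocity $\exists_f(\alpha\wedge f^*\beta)=\exists_f\alpha\wedge\beta$. The equality predicate on $A$ is $\delta_A=\exists_{\Delta_A}\top_A\in P(A\times A)$. We use the internal-language notation: e.g. $\delta_B(f(a),f(a'))$ denotes $(f\times f)^*\delta_B$, $\exists a{:}A.\,\phi(y,a)$ denotes $\exists_{\pi_1}\phi$ for $\pi_1:Y\times A\to Y$, etc. A formula $F\in P(Y\times A)$ is a functional relation from $Y$ to $A$ if $F(y,a)\wedge F(y,a')\le\delta_A(a,a')$ (in $P(Y\times A\times A)$) and $\exists a{:}A.\,F(y,a)=\top_Y$. The internal graph of $f:Y\to A$ is $\Gamma f=(f\times\mathrm{id}_A)^*\delta_A\in P(Y\times A)$. An object $A$ is complete if for every object $Y$ and every functional relation $F$ from $Y$ to $A$ there is a unique morphism $f:Y\to A$ in $\mathbb{C}$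 with $\Gamma f=F$. A morphism $f:A\to B$ is internally bijective if $\delta_A=(f\times f)^*\delta_B$ and $\exists_f\top_A=\top_B$. An object $A$ is a $P$-sheaf if for every span $Y\xleftarrow{d}X\xrightarrow{q}A$ in $\mathbb{C}$ with $d$ internally bijective there is a unique $h:Y\to A$ with $h\circ d=q$. -}

module Defs where

open import Level using (Level; _⊔_) renaming (suc to lsuc)
open import Relation.Binary.PropositionalEquality using (_≡_)
open import Data.Product using (Σ; _×_; _,_)

record CartesianCategory (o ℓh : Level) : Set (lsuc (o ⊔ ℓh)) where
  infixr 9 _∘_
  infixr 7 _⊗_
  field
    Obj  : Set o
    _⇒_  : Obj → Obj → Set ℓh
    id   : {A : Obj} → A ⇒ A
    _∘_  : {A B C : Obj} → B ⇒ C → A ⇒ B → A ⇒ C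
    identityˡ : {A B : Obj} (f : A ⇒ B) → id ∘ f ≡ f
    identityʳ : {A B : Obj} (f : A ⇒ B) → f ∘ id ≡ f
    assoc : {A B C D : Obj} (f : C ⇒ D) (g : B ⇒ C) (k : A ⇒ B) →
            (f ∘ g) ∘ k ≡ f ∘ (g ∘ k)
    𝟙 : Obj
    ! : {A : Obj} → A ⇒ 𝟙
    !-unique : {A : Obj} (f : A ⇒ 𝟙) → f ≡ !
    _⊗_ : Obj → Obj → Obj
    π₁ : {A B : Obj} → (A ⊗ B) ⇒ A
    π₂ : {A B : Obj} → (A ⊗ B) ⇒ B
    ⟨_,_⟩ : {X A B : Obj} → X ⇒ A → X ⇒ B → X ⇒ (A ⊗ B)
    π₁-⟨⟩ : {X A B : Obj} (f : X ⇒ A) (g : X ⇒ B) → π₁ ∘ ⟨ f , g ⟩ ≡ f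
    π₂-⟨⟩ : {X A B : Obj} (f : X ⇒ A) (g : X ⇒ B) → π₂ ∘ ⟨ f , g ⟩ ≡ g
    ⟨⟩-unique : {X A B : Obj} (f : X ⇒ A) (g : X ⇒ B) (u : X ⇒ (A ⊗ B)) →
                π₁ ∘ u ≡ f → π₂ ∘ u ≡ g → u ≡ ⟨ f , g ⟩

  Δ : {A : Obj} → A ⇒ (A ⊗ A)
  Δ = ⟨ id , id ⟩

  _⊗₁_ : {A B C D : Obj} → A ⇒ C → B ⇒ D → (A ⊗ B) ⇒ (C ⊗ D)
  f ⊗₁ g = ⟨ f ∘ π₁ , g ∘ π₂ ⟩

  record IsPullback {X Y Z W : Obj} (f : X ⇒ Y) (g : X ⇒ Z) (h : Y ⇒ W) (k : Z ⇒ W)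
         : Set (o ⊔ ℓh) where
    field
      commutes : k ∘ g ≡ h ∘ f
      universal : {V : Obj} (f′ : V ⇒ Y) (g′ : V ⇒ Z) → h ∘ f′ ≡ k ∘ g′ →
        Σ (V ⇒ X) (λ u → (f ∘ u ≡ f′) × (g ∘ u ≡ g′) ×
          ((u′ : V ⇒ X) → f ∘ u′ ≡ f′ → g ∘ u′ ≡ g′ → u′ ≡ u))

-- Doctrines: functors C^op → ISL (inf-semilattices and homomorphisms)

record Doctrine {o h : Level} (C : CartesianCategory o h) (p ℓ : Level)
       : Set (lsuc (o ⊔ h ⊔ p ⊔ ℓ)) where
  open CartesianCategory C
  infix 4 _≤_
  infixr 6 _∧_
  infixr 8 _^*_
  field
    P : Obj → Set p
    _≤_ : {A : Obj} → P A → P A → Set ℓ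
    ≤-refl : {A : Obj} {α : P A} → α ≤ α
    ≤-trans : {A : Obj} {α β γ : P A} → α ≤ β → β ≤ γ → α ≤ γ
    ≤-antisym : {A : Obj} {α β : P A} → α ≤ β → β ≤ α → α ≡ β
    _∧_ : {A : Obj} → P A → P A → P A
    ∧-lb₁ : {A : Obj} (α β : P A) → α ∧ β ≤ α
    ∧-lb₂ : {A : Obj} (α β : P A) → α ∧ β ≤ β
    ∧-glb : {A : Obj} {α β γ : P A} → γ ≤ α → γ ≤ β → γ ≤ α ∧ β
    ⊤ₚ : (A : Obj) → P A
    ⊤-max : {A : Obj} (α : P A) → α ≤ ⊤ₚ A
    _^*_ : {A B : Obj} → A ⇒ B → P B → P A
    ^*-∧ : {A B : Obj} (f : A ⇒ B) (α β : P B) → f ^* (α ∧ β) ≡ (f ^* α) ∧ (f ^* β)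
    ^*-⊤ : {A B : Obj} (f : A ⇒ B) → f ^* ⊤ₚ B ≡ ⊤ₚ A
    ^*-id : {A : Obj} (α : P A) → id ^* α ≡ α
    ^*-∘ : {A B C : Obj} (g : B ⇒ C) (f : A ⇒ B) (α : P C) →
           (g ∘ f) ^* α ≡ f ^* (g ^* α)

record ElementaryExistentialDoctrine (o h p ℓ : Level)
       : Set (lsuc (o ⊔ h ⊔ p ⊔ ℓ)) where
  field
    cat : CartesianCategory o h
    doctrine : Doctrine cat p ℓ
  open CartesianCategory cat public
  open Doctrine doctrine public
  field
    ∃ₚ : {A B : Obj} → A ⇒ B → P A → P B
    ∃-adj₁ : {A B : Obj} (f : A ⇒ B) {α : P A} {β : P B} → ∃ₚ f α ≤ β → α ≤ f ^* β
    ∃-adj₂ : {A B : Obj} (f : A ⇒ B) {α : P A} {β : P B} → α ≤ f ^* β → ∃ₚ f α ≤ β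
    beck-chevalley : {X Y Z W : Obj} {f : X ⇒ Y} {g : X ⇒ Z} {h : Y ⇒ W} {k : Z ⇒ W} →
      IsPullback f g h k → (γ : P Z) → ∃ₚ f (g ^* γ) ≡ h ^* (∃ₚ k γ)
    frobenius : {A B : Obj} (f : A ⇒ B) (α : P A) (β : P B) →
      ∃ₚ f (α ∧ f ^* β) ≡ ∃ₚ f α ∧ β

module _ {o h p ℓ : Level} (D : ElementaryExistentialDoctrine o h p ℓ) where
  open ElementaryExistentialDoctrine D

  δ : (A : Obj) → P (A ⊗ A)
  δ A = ∃ₚ Δ (⊤ₚ A)

  -- F ∈ P(Y × A) is a functional relation from Y to A:
  --   F(y,a) ∧ F(y,a') ≤ δ_A(a,a')  in P((Y × A) × A)
  --   ∃a:A. F(y,a) = ⊤_Y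
  record IsFunctionalRelation {Y A : Obj} (F : P (Y ⊗ A)) : Set (p ⊔ ℓ) where
    field
      single-valued :
        (⟨ π₁ ∘ π₁ , π₂ ∘ π₁ ⟩ ^* F) ∧ (⟨ π₁ ∘ π₁ , π₂ ⟩ ^* F)
          ≤ ⟨ π₂ ∘ π₁ , π₂ ⟩ ^* δ A
      total : ∃ₚ π₁ F ≡ ⊤ₚ Y

  Γ : {Y A : Obj} → Y ⇒ A → P (Y ⊗ A)
  Γ {A = A} f = (f ⊗₁ id) ^* δ A

  IsComplete : Obj → Set (o ⊔ h ⊔ p ⊔ ℓ)
  IsComplete A = (Y : Obj) (F : P (Y ⊗ A)) → IsFunctionalRelation F →
    Σ (Y ⇒ A) (λ f → (Γ f ≡ F) × ((g : Y ⇒ A) → Γ g ≡ F → g ≡ f))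

  IsInternallyBijective : {A B : Obj} → A ⇒ B → Set p
  IsInternallyBijective {A} {B} f = (δ A ≡ (f ⊗₁ f) ^* δ B) × (∃ₚ f (⊤ₚ A) ≡ ⊤ₚ B)

  IsPSheaf : Obj → Set (o ⊔ h ⊔ p)
  IsPSheaf A = (Y X : Obj) (d : X ⇒ Y) (q : X ⇒ A) → IsInternallyBijective d →
    Σ (Y ⇒ A) (λ k → (k ∘ d ≡ q) × ((k′ : Y ⇒ A) → k′ ∘ d ≡ q → k′ ≡ k))

-- Let A be complete and let Y ←d– X –q→ A be a span with d internally
-- bijective.  Reading the span as the relation
--     F(y, a)  =  ∃x:X. δ(d x, y) ∧ δ(q x, a),
-- F is a functional relation from Y to A: it is total because d is
-- internally surjective, and single-valued because d is internally injective.
-- Completeness yields k : Y → A with Γk = F; then δ(k d x, q x) holds for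
-- every x, and uniqueness follows since d is internally surjective.  Both
-- conclusions turn an internal equality ⊤ ≤ δ(g, k) into g ≡ k: graphs are
-- functional relations, so a complete object is separated.
module Submission where

open import Defs
open import Level using (Level)
open import Data.Product using (_,_; proj₁; proj₂)
open import Relation.Binary.PropositionalEquality using (_≡_; refl; sym; trans; cong; cong₂; subst; subst₂; isEquivalence; module ≡-Reasoning)
open import Relation.Binary.Bundles using (Preorder)
import Relation.Binary.Reasoning.Preorder as PreorderReasoning

module ProductFacts {o h : Level} (C : CartesianCategory o h) where
  open CartesianCategory C

  pull-∘ : {V X Y Z : Obj} {p : Y ⇒ Z} {u : X ⇒ Y} {f : X ⇒ Z} (k : V ⇒ X) →
           p ∘ u ≡ f → p ∘ (u ∘ k) ≡ f ∘ k
  pull-∘ {p = p} {u} k e = trans (sym (assoc p u k)) (cong (_∘ k) e)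

  ⟨⟩∘ : {V X A B : Obj} (f : X ⇒ A) (g : X ⇒ B) (k : V ⇒ X) →
        ⟨ f , g ⟩ ∘ k ≡ ⟨ f ∘ k , g ∘ k ⟩
  ⟨⟩∘ f g k = ⟨⟩-unique (f ∘ k) (g ∘ k) (⟨ f , g ⟩ ∘ k)
    (pull-∘ k (π₁-⟨⟩ f g)) (pull-∘ k (π₂-⟨⟩ f g))

  ∘π₁-⟨⟩ : {X A B C : Obj} (f : A ⇒ C) (g : X ⇒ A) (k : X ⇒ B) →
           (f ∘ π₁) ∘ ⟨ g , k ⟩ ≡ f ∘ g
  ∘π₁-⟨⟩ f g k = trans (assoc f π₁ ⟨ g , k ⟩) (cong (f ∘_) (π₁-⟨⟩ g k))

  ∘π₂-⟨⟩ : {X A B C : Obj} (f : B ⇒ C) (g : X ⇒ A) (k : X ⇒ B) →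
           (f ∘ π₂) ∘ ⟨ g , k ⟩ ≡ f ∘ k
  ∘π₂-⟨⟩ f g k = trans (assoc f π₂ ⟨ g , k ⟩) (cong (f ∘_) (π₂-⟨⟩ g k))

  ⟨π₁,π₂⟩ : {A B : Obj} → ⟨ π₁ , π₂ ⟩ ≡ id {A ⊗ B}
  ⟨π₁,π₂⟩ = sym (⟨⟩-unique π₁ π₂ id (identityʳ π₁) (identityʳ π₂))

  ⊗₁∘⟨⟩ : {V A B C E : Obj} (f : A ⇒ C) (g : B ⇒ E) (s : V ⇒ A) (t : V ⇒ B) →
          (f ⊗₁ g) ∘ ⟨ s , t ⟩ ≡ ⟨ f ∘ s , g ∘ t ⟩
  ⊗₁∘⟨⟩ f g s t = trans (⟨⟩∘ (f ∘ π₁) (g ∘ π₂) ⟨ s , t ⟩)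
    (cong₂ ⟨_,_⟩ (∘π₁-⟨⟩ f s t) (∘π₂-⟨⟩ g s t))

  ⊗₁-id : {A B C : Obj} (f : A ⇒ B) → f ⊗₁ id {C} ≡ ⟨ f ∘ π₁ , π₂ ⟩
  ⊗₁-id f = cong ⟨ f ∘ π₁ ,_⟩ (identityˡ π₂)

  diagonal-retraction : {B C : Obj} (j : (B ⊗ B) ⇒ B) → j ∘ Δ ≡ id →
                        ⟨ j ∘ π₁ , π₂ ⟩ ∘ (Δ ⊗₁ id {C}) ≡ id
  diagonal-retraction j jΔ = begin
    ⟨ j ∘ π₁ , π₂ ⟩ ∘ (Δ ⊗₁ id)                  ≡⟨ ⟨⟩∘ (j ∘ π₁) π₂ (Δ ⊗₁ id) ⟩
    ⟨ (j ∘ π₁) ∘ (Δ ⊗₁ id) , π₂ ∘ (Δ ⊗₁ id) ⟩   ≡⟨ cong₂ ⟨_,_⟩ (∘π₁-⟨⟩ j (Δ ∘ π₁) (id ∘ π₂)) (π₂-⟨⟩ (Δ ∘ π₁) (id ∘ π₂)) ⟩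
    ⟨ j ∘ (Δ ∘ π₁) , id ∘ π₂ ⟩                   ≡⟨ cong₂ ⟨_,_⟩ (trans (sym (assoc j Δ π₁)) (trans (cong (_∘ π₁) jΔ) (identityˡ π₁))) (identityˡ π₂) ⟩
    ⟨ π₁ , π₂ ⟩                                  ≡⟨ ⟨π₁,π₂⟩ ⟩
    id                                           ∎
    where open ≡-Reasoning

  product-pullback : {X Y C : Obj} (m : X ⇒ Y) → IsPullback (m ⊗₁ id {C}) π₁ π₁ m
  product-pullback {X} {Y} {C} m = record
    { commutes = sym (π₁-⟨⟩ (m ∘ π₁) (id ∘ π₂))
    ; universal = λ f′ g′ e →
        ⟨ g′ , π₂ ∘ f′ ⟩
        , trans (⊗₁∘⟨⟩ m id g′ (π₂ ∘ f′))
            (trans (cong₂ ⟨_,_⟩ (sym e) (identityˡ (π₂ ∘ f′))) (sym (⟨⟩-unique _ _ f′ refl refl)))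
        , π₁-⟨⟩ g′ (π₂ ∘ f′)
        , λ u′ e₁ e₂ → ⟨⟩-unique g′ (π₂ ∘ f′) u′ e₂ (sym (second-component u′ e₁))
    }
    where
      second-component : {V : Obj} (u′ : V ⇒ (X ⊗ C)) {f′ : V ⇒ (Y ⊗ C)} →
                         (m ⊗₁ id) ∘ u′ ≡ f′ → π₂ ∘ f′ ≡ π₂ ∘ u′
      second-component u′ e₁ = trans (cong (π₂ ∘_) (sym e₁))
        (trans (pull-∘ u′ (π₂-⟨⟩ (m ∘ π₁) (id ∘ π₂))) (cong (_∘ u′) (identityˡ π₂)))

  pullback-transpose : {X Y Z W : Obj} {f : X ⇒ Y} {g : X ⇒ Z} {h : Y ⇒ W} {k : Z ⇒ W} →
                       IsPullback f g h k → IsPullback g f k h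
  pullback-transpose pb = record
    { commutes = sym (IsPullback.commutes pb)
    ; universal = λ f′ g′ e →
        let (u , e₁ , e₂ , unique) = IsPullback.universal pb g′ f′ (sym e)
        in u , e₂ , e₁ , λ u′ e₁′ e₂′ → unique u′ e₂′ e₁′
    }

module DoctrineFacts {o h p ℓ : Level} {C : CartesianCategory o h} (𝒫 : Doctrine C p ℓ) where
  open CartesianCategory C
  open Doctrine 𝒫

  fibre : Obj → Preorder p p ℓ
  fibre A = record
    { Carrier = P A ; _≈_ = _≡_ ; _≲_ = _≤_
    ; isPreorder = record { isEquivalence = isEquivalence ; reflexive = λ { refl → ≤-refl } ; trans = ≤-trans } }

  module ≤-Reasoning {A : Obj} = PreorderReasoning (fibre A)

  ^*-∘≡ : {A B C : Obj} {g : B ⇒ C} {f : A ⇒ B} {k : A ⇒ C} (α : P C) →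
          g ∘ f ≡ k → f ^* g ^* α ≡ k ^* α
  ^*-∘≡ {g = g} {f} α e = trans (sym (^*-∘ g f α)) (cong (_^* α) e)

  -- Reindexing is monotone, since it preserves meets.
  ^*-mono : {A B : Obj} (f : A ⇒ B) {α β : P B} → α ≤ β → f ^* α ≤ f ^* β
  ^*-mono f {α} {β} α≤β = begin
    f ^* α            ≡⟨ cong (f ^*_) (≤-antisym (∧-glb ≤-refl α≤β) (∧-lb₁ α β)) ⟩
    f ^* (α ∧ β)      ≡⟨ ^*-∧ f α β ⟩
    f ^* α ∧ f ^* β   ≲⟨ ∧-lb₂ _ _ ⟩
    f ^* β            ∎
    where open ≤-Reasoning

  ∧-swap : {A : Obj} {α β : P A} → α ∧ β ≤ β ∧ α
  ∧-swap = ∧-glb (∧-lb₂ _ _) (∧-lb₁ _ _)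

  ⊤-unique : {A : Obj} {α : P A} → ⊤ₚ A ≤ α → α ≡ ⊤ₚ A
  ⊤-unique = ≤-antisym (⊤-max _)

  ⊤≤-reindex : {A B : Obj} (f : A ⇒ B) {α : P B} → ⊤ₚ B ≤ α → ⊤ₚ A ≤ f ^* α
  ⊤≤-reindex f ⊤≤α = subst (_≤ f ^* _) (^*-⊤ f) (^*-mono f ⊤≤α)

module ExistentialFacts {o h p ℓ : Level} (D : ElementaryExistentialDoctrine o h p ℓ) where
  open ElementaryExistentialDoctrine D
  open ProductFacts cat
  open DoctrineFacts doctrine

  unit : {A B : Obj} (f : A ⇒ B) (α : P A) → α ≤ f ^* ∃ₚ f α
  unit f α = ∃-adj₁ f ≤-refl

  ∃-intro : {V W X : Obj} (w : V ⇒ W) (x : V ⇒ X) (ρ : P (W ⊗ X)) →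
            ⟨ w , x ⟩ ^* ρ ≤ w ^* ∃ₚ π₁ ρ
  ∃-intro w x ρ = begin
    ⟨ w , x ⟩ ^* ρ                 ≲⟨ ^*-mono ⟨ w , x ⟩ (unit π₁ ρ) ⟩
    ⟨ w , x ⟩ ^* π₁ ^* ∃ₚ π₁ ρ     ≡⟨ ^*-∘≡ (∃ₚ π₁ ρ) (π₁-⟨⟩ w x) ⟩
    w ^* ∃ₚ π₁ ρ                   ∎
    where open ≤-Reasoning

  -- Beck–Chevalley for the product pullback: ∃ commutes with substitution
  -- in the other component.
  ∃π₁-reindex : {Z W X : Obj} (m : Z ⇒ W) (ρ : P (W ⊗ X)) →
                m ^* ∃ₚ π₁ ρ ≡ ∃ₚ π₁ (⟨ m ∘ π₁ , π₂ ⟩ ^* ρ)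
  ∃π₁-reindex m ρ = trans (sym (beck-chevalley (pullback-transpose (product-pullback m)) ρ))
                          (cong (λ u → ∃ₚ π₁ (u ^* ρ)) (⊗₁-id m))

  -- ∃-elimination: to derive γ from ∃x. ρ(m z, x) and β(z), it suffices
  -- to derive it from ρ(m z, x) and β(z) for a fresh variable x.
  ∃-elim : {Z W X : Obj} (m : Z ⇒ W) (ρ : P (W ⊗ X)) (β γ : P Z) →
           ⟨ m ∘ π₁ , π₂ ⟩ ^* ρ ∧ π₁ ^* β ≤ π₁ ^* γ → m ^* ∃ₚ π₁ ρ ∧ β ≤ γ
  ∃-elim m ρ β γ H = begin
    m ^* ∃ₚ π₁ ρ ∧ β                           ≡⟨ cong (_∧ β) (∃π₁-reindex m ρ) ⟩
    ∃ₚ π₁ (⟨ m ∘ π₁ , π₂ ⟩ ^* ρ) ∧ β           ≡⟨ frobenius π₁ _ β ⟨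
    ∃ₚ π₁ (⟨ m ∘ π₁ , π₂ ⟩ ^* ρ ∧ π₁ ^* β)     ≲⟨ ∃-adj₂ π₁ H ⟩
    γ                                         ∎
    where open ≤-Reasoning

  ∃∃-elim : {Z W X : Obj} (m m′ : Z ⇒ W) (ρ : P (W ⊗ X)) (θ : P Z) →
            ⟨ m ∘ (π₁ ∘ π₁ {Z ⊗ X} {X}) , π₂ ∘ π₁ ⟩ ^* ρ ∧ ⟨ m′ ∘ (π₁ ∘ π₁) , π₂ ⟩ ^* ρ
              ≤ (π₁ ∘ π₁) ^* θ →
            m ^* ∃ₚ π₁ ρ ∧ m′ ^* ∃ₚ π₁ ρ ≤ θ
  ∃∃-elim {Z} {W} {X} m m′ ρ θ H = ∃-elim m ρ (m′ ^* ∃ₚ π₁ ρ) θ first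
    where
      open ≤-Reasoning
      ρₘ : P (Z ⊗ X)
      ρₘ = ⟨ m ∘ π₁ , π₂ ⟩ ^* ρ
      second : (m′ ∘ π₁) ^* ∃ₚ π₁ ρ ∧ ρₘ ≤ π₁ ^* θ
      second = ∃-elim (m′ ∘ π₁) ρ ρₘ (π₁ ^* θ) (begin
        ⟨ (m′ ∘ π₁) ∘ π₁ , π₂ ⟩ ^* ρ ∧ π₁ ^* ρₘ
          ≡⟨ cong₂ _∧_ (cong (λ u → ⟨ u , π₂ ⟩ ^* ρ) (assoc m′ π₁ π₁))
                       (^*-∘≡ ρ (trans (⟨⟩∘ (m ∘ π₁) π₂ π₁) (cong ⟨_, π₂ ∘ π₁ ⟩ (assoc m π₁ π₁)))) ⟩
        ⟨ m′ ∘ (π₁ ∘ π₁) , π₂ ⟩ ^* ρ ∧ ⟨ m ∘ (π₁ ∘ π₁) , π₂ ∘ π₁ ⟩ ^* ρ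
          ≲⟨ ≤-trans ∧-swap H ⟩
        (π₁ ∘ π₁) ^* θ
          ≡⟨ ^*-∘ π₁ π₁ θ ⟩
        π₁ ^* π₁ ^* θ ∎)
      first : ρₘ ∧ π₁ ^* m′ ^* ∃ₚ π₁ ρ ≤ π₁ ^* θ
      first = subst (λ β → ρₘ ∧ β ≤ π₁ ^* θ) (^*-∘ m′ π₁ (∃ₚ π₁ ρ)) (≤-trans ∧-swap second)

  surjective-⊤ : {X Y : Obj} {d : X ⇒ Y} {α : P Y} →
                 ∃ₚ d (⊤ₚ X) ≡ ⊤ₚ Y → ⊤ₚ X ≤ d ^* α → ⊤ₚ Y ≤ α
  surjective-⊤ {d = d} {α} d-surj ⊤≤d*α = subst (_≤ α) d-surj (∃-adj₂ d ⊤≤d*α)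

module EqualityFacts {o h p ℓ : Level} (D : ElementaryExistentialDoctrine o h p ℓ) where
  open ElementaryExistentialDoctrine D
  open ProductFacts cat
  open DoctrineFacts doctrine
  open ExistentialFacts D

  δ⟨_,_⟩ : {Z B : Obj} → Z ⇒ B → Z ⇒ B → P Z
  δ⟨_,_⟩ {B = B} s t = ⟨ s , t ⟩ ^* δ D B

  δ-reindex : {V Z B : Obj} (f : V ⇒ Z) (s t : Z ⇒ B) →
              f ^* δ⟨ s , t ⟩ ≡ δ⟨ s ∘ f , t ∘ f ⟩
  δ-reindex {B = B} f s t = ^*-∘≡ (δ D B) (⟨⟩∘ s t f)

  δ-refl : {Z B : Obj} (s : Z ⇒ B) → ⊤ₚ Z ≤ δ⟨ s , s ⟩
  δ-refl {B = B} s =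
    subst (⊤ₚ _ ≤_) (^*-∘≡ (δ D B) (trans (⟨⟩∘ id id s) (cong₂ ⟨_,_⟩ (identityˡ s) (identityˡ s))))
      (⊤≤-reindex s (unit Δ (⊤ₚ B)))

  -- Along Δ × C both instances of φ become φ itself, so the claim follows
  -- from δ = ∃_Δ ⊤, Beck–Chevalley and Frobenius.
  leibniz : {B C : Obj} (φ : P (B ⊗ C)) →
            π₁ ^* δ D B ∧ ⟨ π₁ ∘ π₁ , π₂ ⟩ ^* φ ≤ ⟨ π₂ ∘ π₁ , π₂ ⟩ ^* φ
  leibniz {B} {C} φ = begin
    π₁ ^* ∃ₚ Δ (⊤ₚ B) ∧ φ₁                 ≡⟨ cong (_∧ φ₁) (beck-chevalley (product-pullback Δ) (⊤ₚ B)) ⟨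
    ∃ₚ e (π₁ ^* ⊤ₚ B) ∧ φ₁                 ≡⟨ frobenius e _ φ₁ ⟨
    ∃ₚ e (π₁ ^* ⊤ₚ B ∧ e ^* φ₁)            ≲⟨ ∃-adj₂ e (≤-trans (∧-lb₂ _ _) (subst (e ^* φ₁ ≤_) (trans collapse₁ (sym collapse₂)) ≤-refl)) ⟩
    φ₂                                     ∎
    where
      open ≤-Reasoning
      e : (B ⊗ C) ⇒ ((B ⊗ B) ⊗ C)
      e = Δ ⊗₁ id
      φ₁ φ₂ : P ((B ⊗ B) ⊗ C)
      φ₁ = ⟨ π₁ ∘ π₁ , π₂ ⟩ ^* φ
      φ₂ = ⟨ π₂ ∘ π₁ , π₂ ⟩ ^* φ
      collapse₁ : e ^* φ₁ ≡ φ
      collapse₁ = trans (^*-∘≡ φ (diagonal-retraction π₁ (π₁-⟨⟩ id id))) (^*-id φ)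
      collapse₂ : e ^* φ₂ ≡ φ
      collapse₂ = trans (^*-∘≡ φ (diagonal-retraction π₂ (π₂-⟨⟩ id id))) (^*-id φ)

  δ-subst : {Z B C : Obj} (s t : Z ⇒ B) (c : Z ⇒ C) (φ : P (B ⊗ C)) →
            δ⟨ s , t ⟩ ∧ ⟨ s , c ⟩ ^* φ ≤ ⟨ t , c ⟩ ^* φ
  δ-subst {Z} {B} {C} s t c φ = begin
    δ⟨ s , t ⟩ ∧ ⟨ s , c ⟩ ^* φ                        ≡⟨ cong₂ _∧_ (^*-∘≡ (δ D B) (π₁-⟨⟩ ⟨ s , t ⟩ c)) (^*-∘≡ φ (select π₁ (π₁-⟨⟩ s t))) ⟨
    w ^* π₁ ^* δ D B ∧ w ^* ⟨ π₁ ∘ π₁ , π₂ ⟩ ^* φ      ≡⟨ ^*-∧ w _ _ ⟨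
    w ^* (π₁ ^* δ D B ∧ ⟨ π₁ ∘ π₁ , π₂ ⟩ ^* φ)        ≲⟨ ^*-mono w (leibniz φ) ⟩
    w ^* ⟨ π₂ ∘ π₁ , π₂ ⟩ ^* φ                         ≡⟨ ^*-∘≡ φ (select π₂ (π₂-⟨⟩ s t)) ⟩
    ⟨ t , c ⟩ ^* φ                                     ∎
    where
      open ≤-Reasoning
      w : Z ⇒ ((B ⊗ B) ⊗ C)
      w = ⟨ ⟨ s , t ⟩ , c ⟩
      select : (j : (B ⊗ B) ⇒ B) {r : Z ⇒ B} → j ∘ ⟨ s , t ⟩ ≡ r → ⟨ j ∘ π₁ , π₂ ⟩ ∘ w ≡ ⟨ r , c ⟩
      select j e = trans (⟨⟩∘ (j ∘ π₁) π₂ w)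
        (cong₂ ⟨_,_⟩ (trans (∘π₁-⟨⟩ j ⟨ s , t ⟩ c) e) (π₂-⟨⟩ ⟨ s , t ⟩ c))

  δ-sym : {Z B : Obj} {Λ : P Z} {s t : Z ⇒ B} → Λ ≤ δ⟨ s , t ⟩ → Λ ≤ δ⟨ t , s ⟩
  δ-sym {B = B} {s = s} {t} Λ≤s=t =
    ≤-trans (∧-glb Λ≤s=t (≤-trans (⊤-max _) (δ-refl s))) (δ-subst s t s (δ D B))

  δ-trans : {Z B : Obj} {Λ : P Z} {s t u : Z ⇒ B} →
            Λ ≤ δ⟨ s , t ⟩ → Λ ≤ δ⟨ t , u ⟩ → Λ ≤ δ⟨ s , u ⟩
  δ-trans {B = B} {s = s} {t} {u} Λ≤s=t Λ≤t=u =
    ≤-trans (∧-glb (δ-sym Λ≤s=t) Λ≤t=u) (δ-subst t s u (δ D B))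

  δ-⊗ : {Z B C : Obj} (f : B ⇒ C) (s t : Z ⇒ B) →
        ⟨ s , t ⟩ ^* (f ⊗₁ f) ^* δ D C ≡ δ⟨ f ∘ s , f ∘ t ⟩
  δ-⊗ {C = C} f s t = ^*-∘≡ (δ D C) (⊗₁∘⟨⟩ f f s t)

  δ-map : {Z B C : Obj} (f : B ⇒ C) (s t : Z ⇒ B) → δ⟨ s , t ⟩ ≤ δ⟨ f ∘ s , f ∘ t ⟩
  δ-map {B = B} {C} f s t = subst (δ⟨ s , t ⟩ ≤_) (δ-⊗ f s t) (^*-mono ⟨ s , t ⟩ δ≤δ)
    where
      δ≤δ : δ D B ≤ (f ⊗₁ f) ^* δ D C
      δ≤δ = ∃-adj₂ Δ (subst (⊤ₚ B ≤_) (sym (δ-⊗ f id id)) (δ-refl (f ∘ id)))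

  surjective-cancel : {X Y B : Obj} {d : X ⇒ Y} (g k : Y ⇒ B) →
                      ∃ₚ d (⊤ₚ X) ≡ ⊤ₚ Y → g ∘ d ≡ k ∘ d → ⊤ₚ Y ≤ δ⟨ g , k ⟩
  surjective-cancel {d = d} g k d-surj gd≡kd = surjective-⊤ d-surj
    (subst (⊤ₚ _ ≤_) (sym (trans (δ-reindex d g k) (cong δ⟨ g ∘ d ,_⟩ (sym gd≡kd)))) (δ-refl (g ∘ d)))

module GraphFacts {o h p ℓ : Level} (D : ElementaryExistentialDoctrine o h p ℓ) where
  open ElementaryExistentialDoctrine D
  open ProductFacts cat
  open DoctrineFacts doctrine
  open ExistentialFacts D
  open EqualityFacts D

  Γ-at : {V Z A : Obj} (f : Z ⇒ A) (a : V ⇒ Z) (b : V ⇒ A) →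
         ⟨ a , b ⟩ ^* Γ D f ≡ δ⟨ f ∘ a , b ⟩
  Γ-at {A = A} f a b = ^*-∘≡ (δ D A) (trans (⊗₁∘⟨⟩ f id a b) (cong ⟨ f ∘ a ,_⟩ (identityˡ b)))

  graph-functional : {Z A : Obj} (f : Z ⇒ A) → IsFunctionalRelation D (Γ D f)
  graph-functional f = record
    { single-valued = subst (_≤ δ⟨ π₂ ∘ π₁ , π₂ ⟩)
        (sym (cong₂ _∧_ (Γ-at f (π₁ ∘ π₁) (π₂ ∘ π₁)) (Γ-at f (π₁ ∘ π₁) π₂)))
        (δ-trans (δ-sym (∧-lb₁ _ _)) (∧-lb₂ _ _))
    ; total = ⊤-unique (begin
        ⊤ₚ _                    ≲⟨ δ-refl f ⟩
        δ⟨ f , f ⟩              ≡⟨ cong δ⟨_, f ⟩ (identityʳ f) ⟨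
        δ⟨ f ∘ id , f ⟩         ≡⟨ Γ-at f id f ⟨
        ⟨ id , f ⟩ ^* Γ D f     ≲⟨ ∃-intro id f (Γ D f) ⟩
        id ^* ∃ₚ π₁ (Γ D f)     ≡⟨ ^*-id _ ⟩
        ∃ₚ π₁ (Γ D f)           ∎)
    }
    where open ≤-Reasoning

  graph-≤ : {Z A : Obj} {g k : Z ⇒ A} → ⊤ₚ Z ≤ δ⟨ g , k ⟩ → Γ D k ≤ Γ D g
  graph-≤ {g = g} {k} ⊤≤g=k =
    δ-trans (≤-trans (⊤-max _) (subst (⊤ₚ _ ≤_) (δ-reindex π₁ g k) (⊤≤-reindex π₁ ⊤≤g=k))) ≤-refl

  -- A complete object is separated: internally equal arrows into it are equal,
  -- since both are the unique arrow whose graph is their common graph.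
  complete⇒separated : {Z A : Obj} → IsComplete D A →
                       (g k : Z ⇒ A) → ⊤ₚ Z ≤ δ⟨ g , k ⟩ → g ≡ k
  complete⇒separated {Z} complete g k ⊤≤g=k with complete Z (Γ D k) (graph-functional k)
  ... | _ , _ , unique = trans (unique g Γg≡Γk) (sym (unique k refl))
    where
      Γg≡Γk : Γ D g ≡ Γ D k
      Γg≡Γk = ≤-antisym (graph-≤ (δ-sym ⊤≤g=k)) (graph-≤ ⊤≤g=k)

module SpanRelation {o h p ℓ : Level} (D : ElementaryExistentialDoctrine o h p ℓ)
                    {Y X A : ElementaryExistentialDoctrine.Obj D}
                    (d : ElementaryExistentialDoctrine._⇒_ D X Y)
                    (q : ElementaryExistentialDoctrine._⇒_ D X A)
                    (d-bijective : IsInternallyBijective D d) where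
  open ElementaryExistentialDoctrine D
  open ProductFacts cat
  open DoctrineFacts doctrine
  open ExistentialFacts D
  open EqualityFacts D

  lies-over : {V : Obj} → V ⇒ Y → V ⇒ A → V ⇒ X → P V
  lies-over y a x = δ⟨ d ∘ x , y ⟩ ∧ δ⟨ q ∘ x , a ⟩

  ρ : P ((Y ⊗ A) ⊗ X)
  ρ = lies-over (π₁ ∘ π₁) (π₂ ∘ π₁) π₂

  F : P (Y ⊗ A)
  F = ∃ₚ π₁ ρ

  ρ-at : {V : Obj} (y : V ⇒ Y) (a : V ⇒ A) (x : V ⇒ X) →
         ⟨ ⟨ y , a ⟩ , x ⟩ ^* ρ ≡ lies-over y a x
  ρ-at {V} y a x = trans (^*-∧ w _ _) (cong₂ _∧_
    (trans (δ-reindex w (d ∘ π₂) (π₁ ∘ π₁)) (cong₂ δ⟨_,_⟩ (∘π₂-⟨⟩ d ⟨ y , a ⟩ x) (trans (∘π₁-⟨⟩ π₁ ⟨ y , a ⟩ x) (π₁-⟨⟩ y a))))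
    (trans (δ-reindex w (q ∘ π₂) (π₂ ∘ π₁)) (cong₂ δ⟨_,_⟩ (∘π₂-⟨⟩ q ⟨ y , a ⟩ x) (trans (∘π₁-⟨⟩ π₂ ⟨ y , a ⟩ x) (π₂-⟨⟩ y a)))))
    where
      w : V ⇒ ((Y ⊗ A) ⊗ X)
      w = ⟨ ⟨ y , a ⟩ , x ⟩

  d-injective : {V : Obj} (s t : V ⇒ X) → δ⟨ s , t ⟩ ≡ δ⟨ d ∘ s , d ∘ t ⟩
  d-injective s t = trans (cong (⟨ s , t ⟩ ^*_) (proj₁ d-bijective)) (δ-⊗ d s t)

  -- Two points over the same y have the same image under q:
  --   d x = y = d x′  gives  x = x′,  hence  a = q x = q x′ = a′.
  images-agree : {V : Obj} (y : V ⇒ Y) (a a′ : V ⇒ A) (x x′ : V ⇒ X) →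
                 lies-over y a x ∧ lies-over y a′ x′ ≤ δ⟨ a , a′ ⟩
  images-agree {V} y a a′ x x′ =
    δ-trans (δ-sym qx=a) (δ-trans (≤-trans x=x′ (δ-map q x x′)) qx′=a′)
    where
      Λ : P V
      Λ = lies-over y a x ∧ lies-over y a′ x′
      dx=y : Λ ≤ δ⟨ d ∘ x , y ⟩
      dx=y = ≤-trans (∧-lb₁ _ _) (∧-lb₁ _ _)
      qx=a : Λ ≤ δ⟨ q ∘ x , a ⟩
      qx=a = ≤-trans (∧-lb₁ _ _) (∧-lb₂ _ _)
      dx′=y : Λ ≤ δ⟨ d ∘ x′ , y ⟩
      dx′=y = ≤-trans (∧-lb₂ _ _) (∧-lb₁ _ _)
      qx′=a′ : Λ ≤ δ⟨ q ∘ x′ , a′ ⟩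
      qx′=a′ = ≤-trans (∧-lb₂ _ _) (∧-lb₂ _ _)
      x=x′ : Λ ≤ δ⟨ x , x′ ⟩
      x=x′ = subst (Λ ≤_) (sym (d-injective x x′)) (δ-trans dx=y (δ-sym dx′=y))

  span⊆F : ⊤ₚ X ≤ ⟨ d , q ⟩ ^* F
  span⊆F = begin
    ⊤ₚ X                             ≲⟨ ∧-glb (refl-after-id d) (refl-after-id q) ⟩
    lies-over d q id                 ≡⟨ ρ-at d q id ⟨
    ⟨ ⟨ d , q ⟩ , id ⟩ ^* ρ          ≲⟨ ∃-intro ⟨ d , q ⟩ id ρ ⟩
    ⟨ d , q ⟩ ^* F                   ∎
    where
      open ≤-Reasoning
      refl-after-id : {B : Obj} (s : X ⇒ B) → ⊤ₚ X ≤ δ⟨ s ∘ id , s ⟩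
      refl-after-id s = subst (λ u → ⊤ₚ X ≤ δ⟨ u , s ⟩) (sym (identityʳ s)) (δ-refl s)

  F-functional : IsFunctionalRelation D F
  F-functional = record
    { single-valued = ∃∃-elim ⟨ π₁ ∘ π₁ , π₂ ∘ π₁ ⟩ ⟨ π₁ ∘ π₁ , π₂ ⟩ ρ δ⟨ π₂ ∘ π₁ , π₂ ⟩
        (subst₂ _≤_ (sym (cong₂ _∧_ (at-pair (π₁ ∘ π₁) (π₂ ∘ π₁) (π₂ ∘ π₁)) (at-pair (π₁ ∘ π₁) π₂ π₂)))
                    (sym (δ-reindex (π₁ ∘ π₁) (π₂ ∘ π₁) π₂))
                    (images-agree _ _ _ (π₂ ∘ π₁) π₂))
    ; total = ⊤-unique (surjective-⊤ (proj₂ d-bijective) (≤-trans span⊆F (∃-intro d q F)))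
    }
    where
      at-pair : (f : ((Y ⊗ A) ⊗ A) ⇒ Y) (g : ((Y ⊗ A) ⊗ A) ⇒ A) (x : ((((Y ⊗ A) ⊗ A) ⊗ X) ⊗ X) ⇒ X) →
                ⟨ ⟨ f , g ⟩ ∘ (π₁ ∘ π₁) , x ⟩ ^* ρ ≡ lies-over (f ∘ (π₁ ∘ π₁)) (g ∘ (π₁ ∘ π₁)) x
      at-pair f g x = trans (cong (λ u → ⟨ u , x ⟩ ^* ρ) (⟨⟩∘ f g (π₁ ∘ π₁))) (ρ-at _ _ x)

proposition3p4 : ∀ {o h p ℓ} (D : ElementaryExistentialDoctrine o h p ℓ)
    (A : ElementaryExistentialDoctrine.Obj D) →
    IsComplete D A → IsPSheaf D A
proposition3p4 D A complete Y X d q d-bijective = k , k∘d≡q , unique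
  where
    open ElementaryExistentialDoctrine D
    open EqualityFacts D
    open GraphFacts D
    open SpanRelation D d q d-bijective

    k : Y ⇒ A
    k = proj₁ (complete Y F F-functional)

    Γk≡F : Γ D k ≡ F
    Γk≡F = proj₁ (proj₂ (complete Y F F-functional))

    k∘d≡q : k ∘ d ≡ q
    k∘d≡q = complete⇒separated complete (k ∘ d) q
      (subst (⊤ₚ X ≤_) (trans (cong (⟨ d , q ⟩ ^*_) (sym Γk≡F)) (Γ-at k d q)) span⊆F)

    unique : (k′ : Y ⇒ A) → k′ ∘ d ≡ q → k′ ≡ k
    unique k′ k′∘d≡q = complete⇒separated complete k′ k
      (surjective-cancel k′ k (proj₂ d-bijective) (trans k′∘d≡q (sym k∘d≡q)))
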